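{- Let $p$ be a prime with $p\equiv 7\pmod{12}$. Then $\mathbb{Z}_p$ contains a primitive 6th root of unity. Fix one such, $u$, and define a relation $\sim$ on $\mathbb{Z}_p^\times$ as follows: if $x,y$ are both quadratic residues or both quadratic non-residues, $x\sim y$ iff $x=y$; if $x=z^2$ and $y=uw^2$ (with $z,w\in\mathbb{Z}_p^\times$), $x\sim y$ iff $z=\pm w$; if $x=uz^2$ and $y=w^2$, $x\sim y$ iff $z=\pm w$. Then $\sim$ is a nontrivial equivalence relation on $\mathbb{Z}_p^\times$.
   Context: An equivalence relation is nontrivial if it has at least two equivalence classes. -}

module Defs where

open import Data.Nat using (ℕ; zero; suc; _∸_; _<_; NonZero)
import Data.Nat as N
open import Data.Nat.DivMod using (_mod_)
open import Data.Fin using (Fin; toℕ)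
open import Data.Product using (Σ; ∃; _×_; _,_; proj₁)
open import Data.Sum using (_⊎_)
open import Relation.Binary.PropositionalEquality using (_≡_; _≢_)
open import Relation.Nullary using (¬_)
open import Relation.Binary.Structures using (IsEquivalence)

module Zp (p : ℕ) .{{_ : NonZero p}} where

  Zₚ : Set
  Zₚ = Fin p

  one : Zₚ
  one = 1 mod p

  _*ₚ_ : Zₚ → Zₚ → Zₚ
  x *ₚ y = (toℕ x N.* toℕ y) mod p

  -ₚ_ : Zₚ → Zₚ
  -ₚ x = (p ∸ toℕ x) mod p

  _^ₚ_ : Zₚ → ℕ → Zₚ
  x ^ₚ zero  = one
  x ^ₚ suc k = x *ₚ (x ^ₚ k)

  PrimitiveRoot6 : Zₚ → Set
  PrimitiveRoot6 u = (u ^ₚ 6 ≡ one) × (∀ k → 0 < k → k < 6 → u ^ₚ k ≢ one)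

  Unit : Set
  Unit = Σ Zₚ (λ x → toℕ x ≢ 0)

  sq : Zₚ → Zₚ
  sq z = z *ₚ z

  QR : Zₚ → Set
  QR x = ∃ λ (z : Unit) → x ≡ sq (proj₁ z)

  QNR : Zₚ → Set
  QNR x = ¬ QR x

  Rel∼ : Zₚ → Unit → Unit → Set
  Rel∼ u (x , _) (y , _) =
      (QR x × QR y × x ≡ y)
    ⊎ (QNR x × QNR y × x ≡ y)
    ⊎ (∃ λ (z : Unit) → ∃ λ (w : Unit) →
         x ≡ sq (proj₁ z) × y ≡ u *ₚ sq (proj₁ w)
         × (proj₁ z ≡ proj₁ w ⊎ proj₁ z ≡ -ₚ proj₁ w))
    ⊎ (∃ λ (z : Unit) → ∃ λ (w : Unit) →
         x ≡ u *ₚ sq (proj₁ z) × y ≡ sq (proj₁ w)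
         × (proj₁ z ≡ proj₁ w ⊎ proj₁ z ≡ -ₚ proj₁ w))

  Nontrivial : (Unit → Unit → Set) → Set
  Nontrivial R = ∃ λ (x : Unit) → ∃ λ (y : Unit) → ¬ R x y

  NontrivialEquivalence : (Unit → Unit → Set) → Set
  NontrivialEquivalence R = IsEquivalence R × Nontrivial R

{-# OPTIONS --safe #-}
-- Every root of Φ₆ = x² − x + 1 in ℤ/p is a primitive sixth root of unity once p > 3.  A root
-- exists when 3 ∤ p − 2: the map x ↦ 1/(1 − x) has order 3 on ℤ/p ∖ {0, 1} and its fixed points
-- are the roots of Φ₆, so without roots it would split ℤ/p ∖ {0, 1} into 3-cycles.  A primitive
-- sixth root u is a nonsquare when 4 ∤ p − 1: from u = s² we get i = s³ with i² = u³ = −1, and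
-- x ↦ i x would split the units into 4-cycles.  Both divisibility conditions hold for p ≡ 7 (mod 12).
-- Since u is a nonsquare, u·x is a nonsquare for every square x, so the only nontrivial links of ∼ are
-- x ∼ u x for squares x and ∼ is an equivalence; 1 ≁ −1 because u ≠ −1.
module Submission where

open import Defs
open import Data.Fin as Fin using (Fin; toℕ; fromℕ<)
open import Data.Fin.Properties using (toℕ-fromℕ<; toℕ-injective; toℕ<n; any?)
open import Data.Fin.Subset using (Subset; _∈_; _∉_; _─_; ∣_∣; inside; outside)
open import Data.Fin.Subset.Properties
  using (p─⊥≡p; p─q⊆p; x∈p∧x≢y⇒x∈p-y; x∉⁅y⁆⇒x≢y; nonempty?; Empty-unique; ∣⊥∣≡0)
open import Data.Integer.Base as ℤ using (ℤ; +_; 0ℤ; 1ℤ)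
open import Data.Integer.Divisibility.Signed
  using (divides; ∣ᵤ⇒∣; ∣⇒∣ᵤ; ∣m∣n⇒∣m+n; ∣n⇒∣m*n; _∣?_) renaming (_∣_ to _∣ℤ_)
open import Data.Integer.DivMod using (_%ℕ_; _/ℕ_; n%ℕd<d; a≡a%ℕn+[a/ℕn]*n)
import Data.Integer.Properties as ℤ
open import Algebra.Properties.Semiring.Exp.TCOptimised ℤ.+-*-semiring using (^-homo-*)
open import Data.Integer.Tactic.RingSolver using (solve; solve-∀; ring)
open import Data.List using (_∷_; [])
open import Data.Nat as ℕ using (ℕ; zero; suc; _%_; _<_; _≤_; _∸_; s≤s; z≤n; NonZero)
open import Data.Nat.Coprimality using (prime⇒coprime; coprime-Bézout)
open import Data.Nat.Divisibility as ℕ∣ using (n∣m*n; ∣m+n∣m⇒∣n; >⇒∤)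
open import Data.Nat.DivMod using (_/_; m≡m%n+[m/n]*n)
open import Data.Nat.GCD using (module Bézout)
open import Data.Nat.Induction using (<-wellFounded)
open import Data.Nat.Primality using (Prime; prime⇒nonZero; prime⇒nonTrivial; euclidsLemma)
import Data.Nat.Properties as ℕ
import Data.Nat.Tactic.RingSolver as ℕ-Solver
open import Data.Product using (∃; _×_; _,_; proj₁; proj₂; map₂)
open import Data.Sum as Sum using (_⊎_; inj₁; inj₂)
open import Function using (_∘_)
open import Induction.WellFounded using (Acc; acc)
open import Relation.Binary.Bundles using (Setoid)
open import Relation.Binary.Definitions using (Decidable)
open import Relation.Binary.PropositionalEquality
import Relation.Binary.Reasoning.Setoid as SetoidReasoning
open import Relation.Binary.Structures using (IsEquivalence)
open import Relation.Nullary using (¬_; Dec; yes; no; map′; contradiction; ¬?)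
open import Relation.Nullary.Decidable using (_×-dec_)
open import Tactic.RingSolver.Core.AlmostCommutativeRing using (module AlmostCommutativeRing)

-- Counting k-cycles

module _ where

  open import Data.Vec using (_∷_; here; there)
  open import Data.Fin.Subset using (_-_)

  x∈p─q⇒x∉q : ∀ {n} {p q : Subset n} {x} → x ∈ p ─ q → x ∉ q
  x∈p─q⇒x∉q {p = _ ∷ _} {outside ∷ _} here         ()
  x∈p─q⇒x∉q {p = _ ∷ _} {_ ∷ _}       (there x∈p─q) (there x∈q) = x∈p─q⇒x∉q x∈p─q x∈q

  x∈p⇒∣p∣≡1+∣p-x∣ : ∀ {n} {p : Subset n} {x} → x ∈ p → ∣ p ∣ ≡ suc ∣ p - x ∣
  x∈p⇒∣p∣≡1+∣p-x∣ {p = inside  ∷ p} here        = cong (suc ∘ ∣_∣) (sym (p─⊥≡p p))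
  x∈p⇒∣p∣≡1+∣p-x∣ {p = inside  ∷ _} (there x∈p) = cong suc (x∈p⇒∣p∣≡1+∣p-x∣ x∈p)
  x∈p⇒∣p∣≡1+∣p-x∣ {p = outside ∷ _} (there x∈p) = x∈p⇒∣p∣≡1+∣p-x∣ x∈p

  x∈p-y⇒x≢y : ∀ {n} {p : Subset n} {x y} → x ∈ p - y → x ≢ y
  x∈p-y⇒x≢y = x∉⁅y⁆⇒x≢y ∘ x∈p─q⇒x∉q

module Cycles {n : ℕ} (f : Fin n → Fin n) where

  open import Data.Nat.Base using (_+_)
  open import Data.Fin.Subset using (_-_)
  open import Function.Endo.Propositional (Fin n) using (_^_; ^-homo)

  record CyclesOfLength (k : ℕ) (p : Subset n) : Set where
    field
      closed    : ∀ {x} → x ∈ p → f x ∈ p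
      periodic  : ∀ {x} → x ∈ p → (f ^ k) x ≡ x
      aperiodic : ∀ {x j} → x ∈ p → 0 < j → j < k → (f ^ j) x ≢ x

  ^-+ : ∀ i j x → (f ^ (i + j)) x ≡ (f ^ i) ((f ^ j) x)
  ^-+ i j x = cong (λ g → g x) (^-homo f i j)

  withoutIterates : Fin n → ℕ → Subset n → Subset n
  withoutIterates x zero    p = p
  withoutIterates x (suc m) p = withoutIterates x m p - (f ^ m) x

  ∈-withoutIterates⁺ : ∀ {x y p} m → y ∈ p → (∀ {j} → j < m → y ≢ (f ^ j) x) →
                       y ∈ withoutIterates x m p
  ∈-withoutIterates⁺ zero    y∈p y≢fʲx = y∈p
  ∈-withoutIterates⁺ (suc m) y∈p y≢fʲx =
    x∈p∧x≢y⇒x∈p-y (∈-withoutIterates⁺ m y∈p (y≢fʲx ∘ ℕ.m<n⇒m<1+n)) (y≢fʲx (ℕ.n<1+n m))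

  ∈-withoutIterates⁻ : ∀ {x y p} m → y ∈ withoutIterates x m p → y ∈ p
  ∈-withoutIterates⁻ zero    y∈q = y∈q
  ∈-withoutIterates⁻ (suc m) y∈q = ∈-withoutIterates⁻ m (p─q⊆p _ _ y∈q)

  ∉-withoutIterates : ∀ {x y p} m → y ∈ withoutIterates x m p → ∀ {j} → j < m → y ≢ (f ^ j) x
  ∉-withoutIterates (suc m) y∈q j<1+m with ℕ.m≤n⇒m<n∨m≡n (ℕ.≤-pred j<1+m)
  ... | inj₁ j<m  = ∉-withoutIterates m (p─q⊆p _ _ y∈q) j<m
  ... | inj₂ refl = x∉⁅y⁆⇒x≢y (x∈p─q⇒x∉q y∈q)

  module _ {k p} (cycles : CyclesOfLength (suc k) p) where
    open CyclesOfLength cycles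

    ^-closed : ∀ {x} j → x ∈ p → (f ^ j) x ∈ p
    ^-closed zero    x∈p = x∈p
    ^-closed (suc j) x∈p = closed (^-closed j x∈p)

    ^-distinct : ∀ {x i j} → x ∈ p → i < j → j < suc k → (f ^ i) x ≢ (f ^ j) x
    ^-distinct {x} {i} {j} x∈p i<j j<1+k fⁱx≡fʲx =
      aperiodic (^-closed i x∈p) (ℕ.m<n⇒0<n∸m i<j) (ℕ.≤-<-trans (ℕ.m∸n≤m j i) j<1+k) (begin
        (f ^ (j ∸ i)) ((f ^ i) x) ≡⟨ ^-+ (j ∸ i) i x ⟨
        (f ^ (j ∸ i + i)) x       ≡⟨ cong (λ m → (f ^ m) x) (ℕ.m∸n+n≡m (ℕ.<⇒≤ i<j)) ⟩
        (f ^ j) x                 ≡⟨ fⁱx≡fʲx ⟨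
        (f ^ i) x                 ∎)
      where open ≡-Reasoning

    ^-inverseˡ : ∀ {x} → x ∈ p → (f ^ k) (f x) ≡ x
    ^-inverseˡ {x} x∈p = begin
      (f ^ k) (f x)     ≡⟨ ^-+ k 1 x ⟨
      (f ^ (k + 1)) x   ≡⟨ cong (λ m → (f ^ m) x) (ℕ.+-comm k 1) ⟩
      (f ^ suc k) x     ≡⟨ periodic x∈p ⟩
      x                 ∎
      where open ≡-Reasoning

    injective : ∀ {x y} → x ∈ p → y ∈ p → f x ≡ f y → x ≡ y
    injective x∈p y∈p fx≡fy =
      trans (sym (^-inverseˡ x∈p)) (trans (cong (f ^ k) fx≡fy) (^-inverseˡ y∈p))

    ∣p∣≡m+∣withoutIterates∣ : ∀ {x} m → x ∈ p → m ≤ suc k → ∣ p ∣ ≡ m + ∣ withoutIterates x m p ∣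
    ∣p∣≡m+∣withoutIterates∣         zero    x∈p _      = refl
    ∣p∣≡m+∣withoutIterates∣ {x} (suc m) x∈p m<1+k = begin
      ∣ p ∣                                          ≡⟨ ∣p∣≡m+∣withoutIterates∣ m x∈p (ℕ.<⇒≤ m<1+k) ⟩
      m + ∣ withoutIterates x m p ∣                  ≡⟨ cong (_+_ m) (x∈p⇒∣p∣≡1+∣p-x∣ fᵐx∈q) ⟩
      m + suc ∣ withoutIterates x m p - (f ^ m) x ∣  ≡⟨ ℕ.+-suc m _ ⟩
      suc m + ∣ withoutIterates x (suc m) p ∣        ∎
      where
      open ≡-Reasoning
      fᵐx∈q : (f ^ m) x ∈ withoutIterates x m p
      fᵐx∈q = ∈-withoutIterates⁺ m (^-closed m x∈p) (λ j<m → ^-distinct x∈p j<m m<1+k ∘ sym)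

    withoutIterates-cycles : ∀ {x} → x ∈ p → CyclesOfLength (suc k) (withoutIterates x (suc k) p)
    withoutIterates-cycles {x} x∈p = record
      { closed    = λ y∈q → ∈-withoutIterates⁺ (suc k) (closed (∈p y∈q)) (fy≢fʲx y∈q)
      ; periodic  = periodic ∘ ∈p
      ; aperiodic = aperiodic ∘ ∈p
      }
      where
      ∈p : ∀ {y} → y ∈ withoutIterates x (suc k) p → y ∈ p
      ∈p = ∈-withoutIterates⁻ (suc k)
      fy≢fʲx : ∀ {y} → y ∈ withoutIterates x (suc k) p → ∀ {j} → j < suc k → f y ≢ (f ^ j) x
      fy≢fʲx y∈q {zero}  _     fy≡x = ∉-withoutIterates (suc k) y∈q ℕ.≤-refl
        (injective (∈p y∈q) (^-closed k x∈p) (trans fy≡x (sym (periodic x∈p))))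
      fy≢fʲx y∈q {suc j} j<1+k fy≡fʲ⁺¹x = ∉-withoutIterates (suc k) y∈q (ℕ.m<n⇒m<1+n (ℕ.≤-pred j<1+k))
        (injective (∈p y∈q) (^-closed j x∈p) fy≡fʲ⁺¹x)

  cycle-length∣size : ∀ {k p} → CyclesOfLength (suc k) p → suc k ℕ∣.∣ ∣ p ∣
  cycle-length∣size {k} {p} cycles = go p cycles (<-wellFounded ∣ p ∣)
    where
    go : ∀ p → CyclesOfLength (suc k) p → Acc _<_ ∣ p ∣ → suc k ℕ∣.∣ ∣ p ∣
    go p cycles (acc rec) with nonempty? p
    ... | no p-empty = subst (suc k ℕ∣.∣_) (sym ∣p∣≡0) (suc k ℕ∣.∣0)
      where
      ∣p∣≡0 : ∣ p ∣ ≡ 0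
      ∣p∣≡0 = trans (cong ∣_∣ (Empty-unique p-empty)) (∣⊥∣≡0 n)
    ... | yes (x , x∈p) = subst (suc k ℕ∣.∣_) (sym ∣p∣≡) (ℕ∣.∣m∣n⇒∣m+n ℕ∣.∣-refl k+1∣∣q∣)
      where
      q = withoutIterates x (suc k) p
      ∣p∣≡ : ∣ p ∣ ≡ suc k + ∣ q ∣
      ∣p∣≡ = ∣p∣≡m+∣withoutIterates∣ cycles (suc k) x∈p ℕ.≤-refl
      k+1∣∣q∣ : suc k ℕ∣.∣ ∣ q ∣
      k+1∣∣q∣ = go q (withoutIterates-cycles cycles x∈p)
        (rec (subst (∣ q ∣ <_) (sym ∣p∣≡) (s≤s (ℕ.m≤n+m ∣ q ∣ k))))

-- Divisibility for p ≡ 7 (mod 12)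

r<d⇒d∤q*d+r : ∀ {d r} q → .{{NonZero r}} → r < d → ¬ d ℕ∣.∣ q ℕ.* d ℕ.+ r
r<d⇒d∤q*d+r q r<d d∣qd+r = >⇒∤ r<d (∣m+n∣m⇒∣n d∣qd+r (n∣m*n q))

m%12≡7⇒m≡7+[m/12]*12 : ∀ {m} → m % 12 ≡ 7 → m ≡ 7 ℕ.+ m / 12 ℕ.* 12
m%12≡7⇒m≡7+[m/12]*12 {m} m%12≡7 = trans (m≡m%n+[m/n]*n m 12) (cong (ℕ._+ m / 12 ℕ.* 12) m%12≡7)

module _ {p : ℕ} (q : ℕ) (p≡7+q*12 : p ≡ 7 ℕ.+ q ℕ.* 12) where

  open ≡-Reasoning

  3∤p∸2 : ¬ 3 ℕ∣.∣ p ∸ 2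
  3∤p∸2 = r<d⇒d∤q*d+r (4 ℕ.* q ℕ.+ 1) (ℕ.n<1+n 2) ∘ subst (3 ℕ∣.∣_) (begin
    p ∸ 2                        ≡⟨ cong (_∸ 2) p≡7+q*12 ⟩
    5 ℕ.+ q ℕ.* 12               ≡⟨ ℕ-Solver.solve (q ∷ []) ⟩
    (4 ℕ.* q ℕ.+ 1) ℕ.* 3 ℕ.+ 2  ∎)

  4∤p∸1 : ¬ 4 ℕ∣.∣ p ∸ 1
  4∤p∸1 = r<d⇒d∤q*d+r (3 ℕ.* q ℕ.+ 1) (ℕ.m<n⇒m<1+n (ℕ.n<1+n 2)) ∘ subst (4 ℕ∣.∣_) (begin
    p ∸ 1                        ≡⟨ cong (_∸ 1) p≡7+q*12 ⟩
    6 ℕ.+ q ℕ.* 12               ≡⟨ ℕ-Solver.solve (q ∷ []) ⟩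
    (3 ℕ.* q ℕ.+ 1) ℕ.* 4 ℕ.+ 2  ∎)

-- Congruence modulo m

module Congruence (m : ℕ) where

  open import Data.Integer.Base using (_+_; _*_; _-_; -_)

  infix 4 _≈_ _≉_ _≈?_

  record _≈_ (a b : ℤ) : Set where
    constructor mk≈
    field m∣a-b : + m ∣ℤ a - b

  _≉_ : ℤ → ℤ → Set
  a ≉ b = ¬ a ≈ b

  -- Every congruence below is derived from known ones by exhibiting a - b as a polynomial
  -- combination of their differences; the ring identity is checked by the solver.
  ≈-by₁ : ∀ {a b x y} → x ≈ y → ∀ c → a - b ≡ c * (x - y) → a ≈ b
  ≈-by₁ (mk≈ m∣x-y) c eq = mk≈ (subst (+ m ∣ℤ_) (sym eq) (∣n⇒∣m*n c m∣x-y))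

  ≈-by₂ : ∀ {a b x₁ y₁ x₂ y₂} → x₁ ≈ y₁ → x₂ ≈ y₂ → ∀ c₁ c₂ →
          a - b ≡ c₁ * (x₁ - y₁) + c₂ * (x₂ - y₂) → a ≈ b
  ≈-by₂ (mk≈ m∣x₁-y₁) (mk≈ m∣x₂-y₂) c₁ c₂ eq =
    mk≈ (subst (+ m ∣ℤ_) (sym eq) (∣m∣n⇒∣m+n (∣n⇒∣m*n c₁ m∣x₁-y₁) (∣n⇒∣m*n c₂ m∣x₂-y₂)))

  ≈-by₃ : ∀ {a b x₁ y₁ x₂ y₂ x₃ y₃} → x₁ ≈ y₁ → x₂ ≈ y₂ → x₃ ≈ y₃ → ∀ c₁ c₂ c₃ →
          a - b ≡ c₁ * (x₁ - y₁) + c₂ * (x₂ - y₂) + c₃ * (x₃ - y₃) → a ≈ b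
  ≈-by₃ (mk≈ m∣x₁-y₁) (mk≈ m∣x₂-y₂) (mk≈ m∣x₃-y₃) c₁ c₂ c₃ eq =
    mk≈ (subst (+ m ∣ℤ_) (sym eq)
      (∣m∣n⇒∣m+n (∣m∣n⇒∣m+n (∣n⇒∣m*n c₁ m∣x₁-y₁) (∣n⇒∣m*n c₂ m∣x₂-y₂)) (∣n⇒∣m*n c₃ m∣x₃-y₃)))

  ≈-refl : ∀ {a} → a ≈ a
  ≈-refl {a} = mk≈ (divides 0ℤ (ℤ.+-inverseʳ a))

  ≈-reflexive : ∀ {a b} → a ≡ b → a ≈ b
  ≈-reflexive refl = ≈-refl

  ≈-sym : ∀ {a b} → a ≈ b → b ≈ a
  ≈-sym {a} {b} a≈b = ≈-by₁ a≈b (- 1ℤ) (solve (a ∷ b ∷ []))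

  ≈-trans : ∀ {a b c} → a ≈ b → b ≈ c → a ≈ c
  ≈-trans {a} {b} {c} a≈b b≈c = ≈-by₂ a≈b b≈c 1ℤ 1ℤ (solve (a ∷ b ∷ c ∷ []))

  ≈-isEquivalence : IsEquivalence _≈_
  ≈-isEquivalence = record { refl = ≈-refl ; sym = ≈-sym ; trans = ≈-trans }

  ≈-setoid : Setoid _ _
  ≈-setoid = record { isEquivalence = ≈-isEquivalence }

  module ≈-Reasoning = SetoidReasoning ≈-setoid

  *-cong : ∀ {a b c d} → a ≈ b → c ≈ d → a * c ≈ b * d
  *-cong {a} {b} {c} {d} a≈b c≈d = ≈-by₂ a≈b c≈d c b (solve (a ∷ b ∷ c ∷ d ∷ []))

  ∣⇒≈0 : ∀ {a} → + m ∣ℤ a → a ≈ 0ℤ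
  ∣⇒≈0 {a} m∣a = mk≈ (subst (+ m ∣ℤ_) (sym (ℤ.+-identityʳ a)) m∣a)

  ≈0⇒∣ : ∀ {a} → a ≈ 0ℤ → + m ∣ℤ a
  ≈0⇒∣ {a} (mk≈ m∣a-0) = subst (+ m ∣ℤ_) (ℤ.+-identityʳ a) m∣a-0

  m-a≈-a : ∀ a → + m - a ≈ - a
  m-a≈-a a = mk≈ (divides 1ℤ (identity (+ m) a))
    where
    identity : ∀ m a → m - a - - a ≡ 1ℤ * m
    identity = solve-∀

  multiple≈0 : ∀ k → k * + m ≈ 0ℤ
  multiple≈0 k = ∣⇒≈0 (divides k refl)

  1+ta≈0⇒a*-t≈1 : ∀ a t → 1ℤ + t * a ≈ 0ℤ → a * - t ≈ 1ℤ
  1+ta≈0⇒a*-t≈1 a t 1+ta≈0 = ≈-by₁ 1+ta≈0 (- 1ℤ) (solve (a ∷ t ∷ []))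

  ta≈1+0⇒a*t≈1 : ∀ a t {k} → t * a ≈ 1ℤ + k → k ≈ 0ℤ → a * t ≈ 1ℤ
  ta≈1+0⇒a*t≈1 a t {k} ta≈1+k k≈0 = ≈-by₂ ta≈1+k k≈0 1ℤ 1ℤ (solve (a ∷ t ∷ k ∷ []))

  _≈?_ : Decidable _≈_
  a ≈? b = map′ mk≈ _≈_.m∣a-b (+ m ∣? a - b)

  open AlmostCommutativeRing ring using (_^_)

  Φ₆-root⇒^6≈1 : ∀ a → a ^ 2 - a + 1ℤ ≈ 0ℤ → a ^ 6 ≈ 1ℤ
  Φ₆-root⇒^6≈1 a Φ₆[a]≈0 = ≈-by₁ Φ₆[a]≈0 ((a ^ 3 - 1ℤ) * (a + 1ℤ)) (solve (a ∷ []))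

  Φ₆-root⇒^k≈1⇒6≈0 : ∀ a → a ^ 2 - a + 1ℤ ≈ 0ℤ → ∀ {k} → 0 < k → k < 6 → a ^ k ≈ 1ℤ → + 6 ≈ 0ℤ
  Φ₆-root⇒^k≈1⇒6≈0 a Φ₆[a]≈0 {1} _ _ aᵏ≈1 =
    ≈-by₂ Φ₆[a]≈0 aᵏ≈1 (+ 6) (- + 6 * a) (solve (a ∷ []))
  Φ₆-root⇒^k≈1⇒6≈0 a Φ₆[a]≈0 {2} _ _ aᵏ≈1 =
    ≈-by₂ Φ₆[a]≈0 aᵏ≈1 (+ 2 * (a + + 2)) (- + 2 * (a + 1ℤ)) (solve (a ∷ []))
  Φ₆-root⇒^k≈1⇒6≈0 a Φ₆[a]≈0 {3} _ _ aᵏ≈1 =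
    ≈-by₂ Φ₆[a]≈0 aᵏ≈1 (+ 3 * (a + 1ℤ)) (- + 3) (solve (a ∷ []))
  Φ₆-root⇒^k≈1⇒6≈0 a Φ₆[a]≈0 {4} _ _ aᵏ≈1 =
    ≈-by₂ Φ₆[a]≈0 aᵏ≈1 (+ 2 * (1ℤ - (a - + 2) * a * (a + 1ℤ))) (+ 2 * (a - + 2)) (solve (a ∷ []))
  Φ₆-root⇒^k≈1⇒6≈0 a Φ₆[a]≈0 {5} _ _ aᵏ≈1 =
    ≈-by₂ Φ₆[a]≈0 aᵏ≈1 (+ 6 * (1ℤ - (a - 1ℤ) * (a ^ 3 + a ^ 2 - 1ℤ))) (+ 6 * (a - 1ℤ)) (solve (a ∷ []))
  Φ₆-root⇒^k≈1⇒6≈0 a _ {suc (suc (suc (suc (suc (suc _)))))} _ (s≤s (s≤s (s≤s (s≤s (s≤s (s≤s ())))))) _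

  1-a≈0⇒a≈1 : ∀ a → 1ℤ - a ≈ 0ℤ → a ≈ 1ℤ
  1-a≈0⇒a≈1 a 1-a≈0 = ≈-by₁ 1-a≈0 (- 1ℤ) (solve (a ∷ []))

  ab≈1⇒b≉0 : ∀ a b → 1ℤ ≉ 0ℤ → a * b ≈ 1ℤ → b ≉ 0ℤ
  ab≈1⇒b≉0 a b 1≉0 ab≈1 b≈0 = 1≉0 (≈-by₂ ab≈1 b≈0 (- 1ℤ) a (solve (a ∷ b ∷ [])))

  möbius-≉1 : ∀ a c → a ≉ 0ℤ → (1ℤ - a) * c ≈ 1ℤ → c ≉ 1ℤ
  möbius-≉1 a c a≉0 c[1-a]≈1 c≈1 = a≉0 (≈-by₂ c[1-a]≈1 c≈1 (- 1ℤ) (1ℤ - a) (solve (a ∷ c ∷ [])))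

  möbius-fixed⇒Φ₆-root : ∀ a → (1ℤ - a) * a ≈ 1ℤ → a ^ 2 - a + 1ℤ ≈ 0ℤ
  möbius-fixed⇒Φ₆-root a a[1-a]≈1 = ≈-by₁ a[1-a]≈1 (- 1ℤ) (solve (a ∷ []))

  möbius³≈id : ∀ a c₁ c₂ c₃ → (1ℤ - a) * c₁ ≈ 1ℤ → (1ℤ - c₁) * c₂ ≈ 1ℤ → (1ℤ - c₂) * c₃ ≈ 1ℤ →
               c₃ * c₁ ≈ a * c₁
  möbius³≈id a c₁ c₂ c₃ h₁ h₂ h₃ =
    ≈-by₃ h₁ h₂ h₃ (c₃ - c₂ * c₃) (- c₃) (a * c₁) (solve (a ∷ c₁ ∷ c₂ ∷ c₃ ∷ []))

  i²≈-1⇒i⁴≈1 : ∀ i → i ^ 2 + 1ℤ ≈ 0ℤ → i ^ 4 ≈ 1ℤ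
  i²≈-1⇒i⁴≈1 i i²+1≈0 = ≈-by₁ i²+1≈0 (i ^ 2 - 1ℤ) (solve (i ∷ []))

  i²≈-1⇒iʲ≈1⇒2≈0 : ∀ i → i ^ 2 + 1ℤ ≈ 0ℤ → ∀ {j} → 0 < j → j < 4 → i ^ j ≈ 1ℤ → + 2 ≈ 0ℤ
  i²≈-1⇒iʲ≈1⇒2≈0 i i²+1≈0 {1} _ _ iʲ≈1 = ≈-by₂ i²+1≈0 iʲ≈1 1ℤ (- (i + 1ℤ)) (solve (i ∷ []))
  i²≈-1⇒iʲ≈1⇒2≈0 i i²+1≈0 {2} _ _ iʲ≈1 = ≈-by₂ i²+1≈0 iʲ≈1 1ℤ (- 1ℤ) (solve (i ∷ []))
  i²≈-1⇒iʲ≈1⇒2≈0 i i²+1≈0 {3} _ _ iʲ≈1 =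
    ≈-by₂ i²+1≈0 iʲ≈1 (1ℤ - i * (i - 1ℤ)) (i - 1ℤ) (solve (i ∷ []))
  i²≈-1⇒iʲ≈1⇒2≈0 i _ {suc (suc (suc (suc _)))} _ (s≤s (s≤s (s≤s (s≤s ())))) _

  a≈s²⇒[s³]²+1≈0 : ∀ a s → a ≈ s * s → a ^ 3 + 1ℤ ≈ 0ℤ → (s ^ 3) ^ 2 + 1ℤ ≈ 0ℤ
  a≈s²⇒[s³]²+1≈0 a s a≈s² a³+1≈0 =
    ≈-by₂ a≈s² a³+1≈0 (- (s ^ 4 + s ^ 2 * a + a ^ 2)) 1ℤ (solve (a ∷ s ∷ []))

  a*c≈-1⇒a+1≈0 : ∀ a c → c ≈ 1ℤ → a * c ≈ - 1ℤ → a + 1ℤ ≈ 0ℤ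
  a*c≈-1⇒a+1≈0 a c c≈1 ac≈-1 = ≈-by₂ ac≈-1 c≈1 1ℤ (- a) (solve (a ∷ c ∷ []))

  a*c≈1⇒a+1≈0 : ∀ a c → c ≈ - 1ℤ → a * c ≈ 1ℤ → a + 1ℤ ≈ 0ℤ
  a*c≈1⇒a+1≈0 a c c≈-1 ac≈1 = ≈-by₂ ac≈1 c≈-1 (- 1ℤ) a (solve (a ∷ c ∷ []))

  a≈-b⇒a²≈b² : ∀ a b → a ≈ - b → a * a ≈ b * b
  a≈-b⇒a²≈b² a b a≈-b = ≈-by₁ a≈-b (a - b) (solve (a ∷ b ∷ []))

  a+1≈0⇒a²≈1 : ∀ a → a + 1ℤ ≈ 0ℤ → a ^ 2 ≈ 1ℤ
  a+1≈0⇒a²≈1 a a+1≈0 = ≈-by₁ a+1≈0 (a - 1ℤ) (solve (a ∷ []))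

  aw²≈z²⇒a≈[zb]² : ∀ a w z b → a * (w * w) ≈ z * z → w * b ≈ 1ℤ → a ≈ (z * b) * (z * b)
  aw²≈z²⇒a≈[zb]² a w z b aw²≈z² wb≈1 =
    ≈-by₂ aw²≈z² wb≈1 (b * b) (- (a * (w * b + 1ℤ))) (solve (a ∷ w ∷ z ∷ b ∷ []))

-- Arithmetic modulo a prime

module Residues (p : ℕ) (p-prime : Prime p) where

  instance
    p≢0 : NonZero p
    p≢0 = prime⇒nonZero p-prime

  open Zp p
  open Congruence p public
  open import Data.Integer.Base using (_+_; _*_; _-_; -_)
  open AlmostCommutativeRing ring using (_^_)

  ⟦_⟧ : Zₚ → ℤ
  ⟦ x ⟧ = + toℕ x

  fromℤ : ℤ → Zₚ
  fromℤ a = fromℕ< (n%ℕd<d a p)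

  ⟦fromℤ⟧ : ∀ a → ⟦ fromℤ a ⟧ ≈ a
  ⟦fromℤ⟧ a = mk≈ (divides (- (a /ℕ p)) (begin
    ⟦ fromℤ a ⟧ - a                             ≡⟨ cong (λ r → + r - a) (toℕ-fromℕ< (n%ℕd<d a p)) ⟩
    + (a %ℕ p) - a                              ≡⟨ cong (λ b → + (a %ℕ p) - b) (a≡a%ℕn+[a/ℕn]*n a p) ⟩
    + (a %ℕ p) - (+ (a %ℕ p) + a /ℕ p * + p)    ≡⟨ r-[r+qp]≡-qp (+ (a %ℕ p)) (a /ℕ p) (+ p) ⟩
    - (a /ℕ p) * + p                            ∎))
    where
    open ≡-Reasoning
    r-[r+qp]≡-qp : ∀ r q p → r - (r + q * p) ≡ - q * p
    r-[r+qp]≡-qp = solve-∀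

  ⟦one⟧ : ⟦ one ⟧ ≈ 1ℤ
  ⟦one⟧ = ⟦fromℤ⟧ 1ℤ

  ⟦*ₚ⟧ : ∀ x y → ⟦ x *ₚ y ⟧ ≈ ⟦ x ⟧ * ⟦ y ⟧
  ⟦*ₚ⟧ x y = ≈-trans (⟦fromℤ⟧ _) (≈-reflexive (ℤ.pos-* (toℕ x) (toℕ y)))

  ⟦-ₚ⟧ : ∀ x → ⟦ -ₚ x ⟧ ≈ - ⟦ x ⟧
  ⟦-ₚ⟧ x = ≈-trans (⟦fromℤ⟧ _) (≈-trans (≈-reflexive p∸x≡p-x) (m-a≈-a ⟦ x ⟧))
    where
    p∸x≡p-x : + (p ∸ toℕ x) ≡ + p - ⟦ x ⟧
    p∸x≡p-x = trans (sym (ℤ.⊖-≥ (ℕ.<⇒≤ (toℕ<n x)))) (sym (ℤ.m-n≡m⊖n p (toℕ x)))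

  ⟦^ₚ⟧ : ∀ x k → ⟦ x ^ₚ k ⟧ ≈ ⟦ x ⟧ ^ k
  ⟦^ₚ⟧ x zero    = ⟦one⟧
  ⟦^ₚ⟧ x (suc k) = begin
    ⟦ x *ₚ (x ^ₚ k) ⟧     ≈⟨ ⟦*ₚ⟧ x (x ^ₚ k) ⟩
    ⟦ x ⟧ * ⟦ x ^ₚ k ⟧    ≈⟨ *-cong (≈-refl {⟦ x ⟧}) (⟦^ₚ⟧ x k) ⟩
    ⟦ x ⟧ * ⟦ x ⟧ ^ k     ≡⟨ ^-homo-* ⟦ x ⟧ 1 k ⟨
    ⟦ x ⟧ ^ suc k         ∎
    where open ≈-Reasoning

  +-≈-injective : ∀ {a b} → a < p → b < p → + a ≈ + b → a ≡ b
  +-≈-injective {a} {b} a<p b<p (mk≈ p∣a-b) =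
    ℤ.+-injective (ℤ.i-j≡0⇒i≡j (+ a) (+ b) (ℤ.∣i∣≡0⇒i≡0 (multiple-below-p≡0 (∣⇒∣ᵤ p∣a-b) ∣a-b∣<p)))
    where
    multiple-below-p≡0 : ∀ {n} → p ℕ∣.∣ n → n < p → n ≡ 0
    multiple-below-p≡0 {zero}  _   _   = refl
    multiple-below-p≡0 {suc _} p∣n n<p = contradiction p∣n (>⇒∤ n<p)
    ∣a-b∣<p : ℤ.∣ + a - + b ∣ < p
    ∣a-b∣<p = subst (_< p) (cong ℤ.∣_∣ (sym (ℤ.m-n≡m⊖n a b)))
                (ℕ.≤-<-trans (ℤ.∣m⊝n∣≤m⊔n a b) (ℕ.⊔-pres-<m a<p b<p))

  ⟦⟧-injective : ∀ {x y} → ⟦ x ⟧ ≈ ⟦ y ⟧ → x ≡ y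
  ⟦⟧-injective {x} {y} = toℕ-injective ∘ +-≈-injective (toℕ<n x) (toℕ<n y)

  ≈⇒≡fromℤ : ∀ {x a} → ⟦ x ⟧ ≈ a → x ≡ fromℤ a
  ≈⇒≡fromℤ {a = a} ⟦x⟧≈a = ⟦⟧-injective (≈-trans ⟦x⟧≈a (≈-sym (⟦fromℤ⟧ a)))

  ≡fromℤ⇒≈ : ∀ {x} a → x ≡ fromℤ a → ⟦ x ⟧ ≈ a
  ≡fromℤ⇒≈ a refl = ⟦fromℤ⟧ a

  +n≉0 : ∀ {n} → 0 < n → n < p → + n ≉ 0ℤ
  +n≉0 0<n n<p n≈0 = ℕ.<⇒≢ 0<n (sym (+-≈-injective n<p (ℕ.≤-<-trans z≤n n<p) n≈0))

  unit⇒≉0 : ∀ {x} → toℕ x ≢ 0 → ⟦ x ⟧ ≉ 0ℤ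
  unit⇒≉0 {x} x≢0 = x≢0 ∘ +-≈-injective (toℕ<n x) (ℕ.≤-<-trans z≤n (toℕ<n x))

  ≉0⇒unit : ∀ {x} → ⟦ x ⟧ ≉ 0ℤ → toℕ x ≢ 0
  ≉0⇒unit ⟦x⟧≉0 = ⟦x⟧≉0 ∘ ≈-reflexive ∘ cong (+_)

  *≈0⇒≈0⊎≈0 : ∀ {a b} → a * b ≈ 0ℤ → a ≈ 0ℤ ⊎ b ≈ 0ℤ
  *≈0⇒≈0⊎≈0 {a} {b} ab≈0
    with euclidsLemma ℤ.∣ a ∣ ℤ.∣ b ∣ p-prime (subst (p ℕ∣.∣_) (ℤ.abs-* a b) (∣⇒∣ᵤ (≈0⇒∣ ab≈0)))
  ... | inj₁ p∣a = inj₁ (∣⇒≈0 (∣ᵤ⇒∣ p∣a))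
  ... | inj₂ p∣b = inj₂ (∣⇒≈0 (∣ᵤ⇒∣ p∣b))

  *-≉0 : ∀ {a b} → a ≉ 0ℤ → b ≉ 0ℤ → a * b ≉ 0ℤ
  *-≉0 a≉0 b≉0 = Sum.[ a≉0 , b≉0 ] ∘ *≈0⇒≈0⊎≈0

  *-cancelˡ : ∀ {a b c} → a ≉ 0ℤ → a * b ≈ a * c → b ≈ c
  *-cancelˡ {a} {b} {c} a≉0 ab≈ac with *≈0⇒≈0⊎≈0 a[b-c]≈0
    where
    a[b-c]≈0 : a * (b - c) ≈ 0ℤ
    a[b-c]≈0 = ≈-by₁ ab≈ac 1ℤ (solve (a ∷ b ∷ c ∷ []))
  ... | inj₁ a≈0   = contradiction a≈0 a≉0
  ... | inj₂ b-c≈0 = ≈-by₁ b-c≈0 1ℤ (solve (b ∷ c ∷ []))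

  *ₚ-cancelˡ : ∀ {u x y} → ⟦ u ⟧ ≉ 0ℤ → u *ₚ x ≡ u *ₚ y → x ≡ y
  *ₚ-cancelˡ {u} {x} {y} u≉0 ux≡uy = ⟦⟧-injective (*-cancelˡ u≉0 (begin
    ⟦ u ⟧ * ⟦ x ⟧  ≈⟨ ⟦*ₚ⟧ u x ⟨
    ⟦ u *ₚ x ⟧     ≡⟨ cong ⟦_⟧ ux≡uy ⟩
    ⟦ u *ₚ y ⟧     ≈⟨ ⟦*ₚ⟧ u y ⟩
    ⟦ u ⟧ * ⟦ y ⟧  ∎))
    where open ≈-Reasoning

  *-cancelʳ : ∀ {a b c} → c ≉ 0ℤ → a * c ≈ b * c → a ≈ b
  *-cancelʳ {a} {b} {c} c≉0 ac≈bc =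
    *-cancelˡ c≉0 (≈-trans (≈-reflexive (ℤ.*-comm c a)) (≈-trans ac≈bc (≈-reflexive (ℤ.*-comm b c))))

  toℤ-1+ab≡cd : ∀ a b c d → 1 ℕ.+ a ℕ.* b ≡ c ℕ.* d → 1ℤ + + a * + b ≡ + c * + d
  toℤ-1+ab≡cd a b c d eq = begin
    1ℤ + + a * + b    ≡⟨ cong (_+_ 1ℤ) (ℤ.pos-* a b) ⟨
    + (1 ℕ.+ a ℕ.* b) ≡⟨ cong (+_) eq ⟩
    + (c ℕ.* d)       ≡⟨ ℤ.pos-* c d ⟩
    + c * + d         ∎
    where open ≡-Reasoning

  invertible : ∀ x → ⟦ x ⟧ ≉ 0ℤ → ∃ λ b → ⟦ x ⟧ * b ≈ 1ℤ
  invertible x x≉0 with coprime-Bézout (prime⇒coprime p-prime {{ℕ.≢-nonZero (≉0⇒unit x≉0)}} (toℕ<n x))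
  ... | Bézout.+- s t 1+tx≡sp = - + t , 1+ta≈0⇒a*-t≈1 ⟦ x ⟧ (+ t)
    (≈-trans (≈-reflexive (toℤ-1+ab≡cd t (toℕ x) s p 1+tx≡sp)) (multiple≈0 (+ s)))
  ... | Bézout.-+ s t 1+sp≡tx = + t , ta≈1+0⇒a*t≈1 ⟦ x ⟧ (+ t)
    (≈-reflexive (sym (toℤ-1+ab≡cd s p t (toℕ x) 1+sp≡tx))) (multiple≈0 (+ s))

  infix 30 _⁻¹

  opaque
    _⁻¹ : Zₚ → Zₚ
    x ⁻¹ with ⟦ x ⟧ ≈? 0ℤ
    ... | yes _   = x
    ... | no x≉0 = fromℤ (proj₁ (invertible x x≉0))

    ⁻¹-inverseʳ : ∀ x → ⟦ x ⟧ ≉ 0ℤ → ⟦ x ⟧ * ⟦ x ⁻¹ ⟧ ≈ 1ℤ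
    ⁻¹-inverseʳ x x≉0 with ⟦ x ⟧ ≈? 0ℤ
    ... | yes x≈0 = contradiction x≈0 x≉0
    ... | no x≉0  = ≈-trans (*-cong (≈-refl {⟦ x ⟧}) (⟦fromℤ⟧ _)) (proj₂ (invertible x x≉0))

  1≉0 : 1ℤ ≉ 0ℤ
  1≉0 = +n≉0 (s≤s z≤n) (ℕ.nonTrivial⇒n>1 p {{prime⇒nonTrivial p-prime}})

  ^suc≈1⇒≉0 : ∀ a k → a ^ suc k ≈ 1ℤ → a ≉ 0ℤ
  ^suc≈1⇒≉0 a k aᵏ⁺¹≈1 a≈0 = 1≉0 (begin
    1ℤ            ≈⟨ ≈-sym aᵏ⁺¹≈1 ⟩
    a ^ suc k     ≡⟨ ^-homo-* a 1 k ⟩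
    a * a ^ k     ≈⟨ *-cong a≈0 (≈-refl {a ^ k}) ⟩
    0ℤ * a ^ k    ≡⟨ ℤ.*-zeroˡ (a ^ k) ⟩
    0ℤ            ∎)
    where open ≈-Reasoning

  ^6≈1⇒^3≈1⊎^3≈-1 : ∀ a → a ^ 6 ≈ 1ℤ → a ^ 3 ≈ 1ℤ ⊎ a ^ 3 + 1ℤ ≈ 0ℤ
  ^6≈1⇒^3≈1⊎^3≈-1 a a⁶≈1 = Sum.map₁ a³-1≈0⇒a³≈1 (*≈0⇒≈0⊎≈0 [a³-1][a³+1]≈0)
    where
    [a³-1][a³+1]≈0 : (a ^ 3 - 1ℤ) * (a ^ 3 + 1ℤ) ≈ 0ℤ
    [a³-1][a³+1]≈0 = ≈-by₁ a⁶≈1 1ℤ (solve (a ∷ []))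
    a³-1≈0⇒a³≈1 : a ^ 3 - 1ℤ ≈ 0ℤ → a ^ 3 ≈ 1ℤ
    a³-1≈0⇒a³≈1 a³-1≈0 = ≈-by₁ a³-1≈0 1ℤ (solve (a ∷ []))

  Φ₆-root⇒primitive : ∀ {u} → + 6 ≉ 0ℤ → ⟦ u ⟧ ^ 2 - ⟦ u ⟧ + 1ℤ ≈ 0ℤ → PrimitiveRoot6 u
  Φ₆-root⇒primitive {u} 6≉0 Φ₆[u]≈0 = u⁶≡1 , uᵏ≢1
    where
    u⁶≡1 : u ^ₚ 6 ≡ one
    u⁶≡1 = ≈⇒≡fromℤ (≈-trans (⟦^ₚ⟧ u 6) (Φ₆-root⇒^6≈1 ⟦ u ⟧ Φ₆[u]≈0))
    uᵏ≢1 : ∀ k → 0 < k → k < 6 → u ^ₚ k ≢ one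
    uᵏ≢1 k 0<k k<6 uᵏ≡1 =
      6≉0 (Φ₆-root⇒^k≈1⇒6≈0 ⟦ u ⟧ Φ₆[u]≈0 0<k k<6 (≈-trans (≈-sym (⟦^ₚ⟧ u k)) (≡fromℤ⇒≈ 1ℤ uᵏ≡1)))

  möbius : Zₚ → Zₚ
  möbius x = fromℤ (1ℤ - ⟦ x ⟧) ⁻¹

  möbius-inverse : ∀ {x} → ⟦ x ⟧ ≉ 1ℤ → (1ℤ - ⟦ x ⟧) * ⟦ möbius x ⟧ ≈ 1ℤ
  möbius-inverse {x} x≉1 = ≈-trans (*-cong (≈-sym 1-x≈) (≈-refl {⟦ möbius x ⟧})) (⁻¹-inverseʳ _ 1-x≉0)
    where
    1-x≈ : ⟦ fromℤ (1ℤ - ⟦ x ⟧) ⟧ ≈ 1ℤ - ⟦ x ⟧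
    1-x≈ = ⟦fromℤ⟧ (1ℤ - ⟦ x ⟧)
    1-x≉0 : ⟦ fromℤ (1ℤ - ⟦ x ⟧) ⟧ ≉ 0ℤ
    1-x≉0 = x≉1 ∘ 1-a≈0⇒a≈1 ⟦ x ⟧ ∘ ≈-trans (≈-sym 1-x≈)

  module _ where

    open import Data.Fin.Subset using (⊤) renaming (_-_ to _∖_)
    open import Data.Fin.Subset.Properties using (∈⊤; ∣⊤∣≡n)
    open import Function.Endo.Propositional Zₚ using () renaming (_^_ to _^ᶠ_)

    ∈-fromℤ⁺ : ∀ {x q a} → x ∈ q → ⟦ x ⟧ ≉ a → x ∈ q ∖ fromℤ a
    ∈-fromℤ⁺ x∈q x≉a = x∈p∧x≢y⇒x∈p-y x∈q (x≉a ∘ ≡fromℤ⇒≈ _)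

    ∈-fromℤ⁻ : ∀ {x q a} → x ∈ q ∖ fromℤ a → x ∈ q × ⟦ x ⟧ ≉ a
    ∈-fromℤ⁻ x∈q-a = p─q⊆p _ _ x∈q-a , x∈p-y⇒x≢y x∈q-a ∘ ≈⇒≡fromℤ

    Nonzero : Subset p
    Nonzero = ⊤ ∖ fromℤ 0ℤ

    NonzeroNonone : Subset p
    NonzeroNonone = Nonzero ∖ fromℤ 1ℤ

    p≡1+∣Nonzero∣ : p ≡ suc ∣ Nonzero ∣
    p≡1+∣Nonzero∣ = trans (sym (∣⊤∣≡n p)) (x∈p⇒∣p∣≡1+∣p-x∣ (∈⊤ {x = fromℤ 0ℤ}))

    ∣Nonzero∣ : ∣ Nonzero ∣ ≡ p ∸ 1
    ∣Nonzero∣ = sym (cong (_∸ 1) p≡1+∣Nonzero∣)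

    ∣NonzeroNonone∣ : ∣ NonzeroNonone ∣ ≡ p ∸ 2
    ∣NonzeroNonone∣ = sym (cong (_∸ 2) (trans p≡1+∣Nonzero∣ (cong suc (x∈p⇒∣p∣≡1+∣p-x∣ 1∈Nonzero))))
      where
      1∈Nonzero : fromℤ 1ℤ ∈ Nonzero
      1∈Nonzero = ∈-fromℤ⁺ ∈⊤ (1≉0 ∘ ≈-trans (≈-sym (⟦fromℤ⟧ 1ℤ)))

    order∣p∸1 : ∀ a k → a ^ suc k ≈ 1ℤ → (∀ {j} → 0 < j → j < suc k → a ^ j ≉ 1ℤ) → suc k ℕ∣.∣ p ∸ 1
    order∣p∸1 a k aᵏ⁺¹≈1 aʲ≉1 = subst (suc k ℕ∣.∣_) ∣Nonzero∣ (cycle-length∣size cycles)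
      where
      g : Zₚ → Zₚ
      g x = fromℤ a *ₚ x
      open Cycles g using (CyclesOfLength; cycle-length∣size)

      ⟦gʲx⟧ : ∀ j x → ⟦ (g ^ᶠ j) x ⟧ ≈ a ^ j * ⟦ x ⟧
      ⟦gʲx⟧ zero    x = ≈-reflexive (sym (ℤ.*-identityˡ ⟦ x ⟧))
      ⟦gʲx⟧ (suc j) x = begin
        ⟦ fromℤ a *ₚ (g ^ᶠ j) x ⟧       ≈⟨ ⟦*ₚ⟧ (fromℤ a) ((g ^ᶠ j) x) ⟩
        ⟦ fromℤ a ⟧ * ⟦ (g ^ᶠ j) x ⟧    ≈⟨ *-cong (⟦fromℤ⟧ a) (⟦gʲx⟧ j x) ⟩
        a * (a ^ j * ⟦ x ⟧)             ≡⟨ ℤ.*-assoc a (a ^ j) ⟦ x ⟧ ⟨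
        a * a ^ j * ⟦ x ⟧               ≡⟨ cong (_* ⟦ x ⟧) (^-homo-* a 1 j) ⟨
        a ^ suc j * ⟦ x ⟧               ∎
        where open ≈-Reasoning

      cycles : CyclesOfLength (suc k) Nonzero
      cycles = record
        { closed    = λ {x} x∈ → ∈-fromℤ⁺ ∈⊤
            (*-≉0 (^suc≈1⇒≉0 a k aᵏ⁺¹≈1) (⟦x⟧≉0 x∈) ∘ ≈-trans (≈-sym (⟦gʲx⟧ 1 x)))
        ; periodic  = λ {x} x∈ → ⟦⟧-injective (begin
            ⟦ (g ^ᶠ suc k) x ⟧   ≈⟨ ⟦gʲx⟧ (suc k) x ⟩
            a ^ suc k * ⟦ x ⟧    ≈⟨ *-cong aᵏ⁺¹≈1 (≈-refl {⟦ x ⟧}) ⟩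
            1ℤ * ⟦ x ⟧           ≡⟨ ℤ.*-identityˡ ⟦ x ⟧ ⟩
            ⟦ x ⟧                ∎)
        ; aperiodic = λ {x} {j} x∈ 0<j j<k+1 gʲx≡x → aʲ≉1 0<j j<k+1 (*-cancelʳ (⟦x⟧≉0 x∈) (begin
            a ^ j * ⟦ x ⟧        ≈⟨ ⟦gʲx⟧ j x ⟨
            ⟦ (g ^ᶠ j) x ⟧       ≡⟨ cong ⟦_⟧ gʲx≡x ⟩
            ⟦ x ⟧                ≡⟨ ℤ.*-identityˡ ⟦ x ⟧ ⟨
            1ℤ * ⟦ x ⟧           ∎))
        }
        where
        open ≈-Reasoning
        ⟦x⟧≉0 : ∀ {x} → x ∈ Nonzero → ⟦ x ⟧ ≉ 0ℤ
        ⟦x⟧≉0 = proj₂ ∘ ∈-fromℤ⁻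

    Φ₆-has-root : ¬ 3 ℕ∣.∣ p ∸ 2 → ∃ λ u → ⟦ u ⟧ ^ 2 - ⟦ u ⟧ + 1ℤ ≈ 0ℤ
    Φ₆-has-root 3∤p∸2 with any? (λ u → ⟦ u ⟧ ^ 2 - ⟦ u ⟧ + 1ℤ ≈? 0ℤ)
    ... | yes root   = root
    ... | no no-root = contradiction (subst (3 ℕ∣.∣_) ∣NonzeroNonone∣ (cycle-length∣size cycles)) 3∤p∸2
      where
      open Cycles möbius using (CyclesOfLength; cycle-length∣size)

      ∈⁻ : ∀ {x} → x ∈ NonzeroNonone → ⟦ x ⟧ ≉ 0ℤ × ⟦ x ⟧ ≉ 1ℤ
      ∈⁻ x∈ = proj₂ (∈-fromℤ⁻ {a = 0ℤ} (proj₁ (∈-fromℤ⁻ {a = 1ℤ} x∈))) , proj₂ (∈-fromℤ⁻ {a = 1ℤ} x∈)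

      closed : ∀ {x} → x ∈ NonzeroNonone → möbius x ∈ NonzeroNonone
      closed {x} x∈ = ∈-fromℤ⁺ (∈-fromℤ⁺ ∈⊤ (ab≈1⇒b≉0 (1ℤ - ⟦ x ⟧) _ 1≉0 m[x]))
                                          (möbius-≉1 ⟦ x ⟧ _ (proj₁ (∈⁻ x∈)) m[x])
        where m[x] = möbius-inverse (proj₂ (∈⁻ x∈))

      periodic : ∀ {x} → x ∈ NonzeroNonone → möbius (möbius (möbius x)) ≡ x
      periodic {x} x∈ = ⟦⟧-injective (*-cancelʳ (ab≈1⇒b≉0 (1ℤ - ⟦ x ⟧) _ 1≉0 m[x])
        (möbius³≈id ⟦ x ⟧ _ _ _ m[x] m[m[x]] m[m[m[x]]]))
        where
        m[x]       = möbius-inverse (proj₂ (∈⁻ x∈))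
        m[m[x]]    = möbius-inverse (proj₂ (∈⁻ (closed x∈)))
        m[m[m[x]]] = möbius-inverse (proj₂ (∈⁻ (closed (closed x∈))))

      unfixed : ∀ {x} → x ∈ NonzeroNonone → möbius x ≢ x
      unfixed {x} x∈ m[x]≡x = no-root (x , möbius-fixed⇒Φ₆-root ⟦ x ⟧
        (subst (λ y → (1ℤ - ⟦ x ⟧) * ⟦ y ⟧ ≈ 1ℤ) m[x]≡x (möbius-inverse (proj₂ (∈⁻ x∈)))))

      aperiodic : ∀ {x j} → x ∈ NonzeroNonone → 0 < j → j < 3 → (möbius ^ᶠ j) x ≢ x
      aperiodic {j = 1}                 x∈ _ _ = unfixed x∈
      aperiodic {j = 2}                 x∈ _ _ m²x≡x =
        unfixed x∈ (trans (cong möbius (sym m²x≡x)) (periodic x∈))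
      aperiodic {j = suc (suc (suc _))} _  _ (s≤s (s≤s (s≤s ())))

      cycles : CyclesOfLength 3 NonzeroNonone
      cycles = record { closed = closed ; periodic = periodic ; aperiodic = aperiodic }

  -- The relation ∼

  -ₚ-square : ∀ z w → z ≡ w ⊎ z ≡ -ₚ w → sq z ≡ sq w
  -ₚ-square z w (inj₁ refl)  = refl
  -ₚ-square z w (inj₂ z≡-w) = ⟦⟧-injective (begin
    ⟦ z *ₚ z ⟧        ≈⟨ ⟦*ₚ⟧ z z ⟩
    ⟦ z ⟧ * ⟦ z ⟧     ≈⟨ a≈-b⇒a²≈b² ⟦ z ⟧ ⟦ w ⟧ z≈-w ⟩
    ⟦ w ⟧ * ⟦ w ⟧     ≈⟨ ⟦*ₚ⟧ w w ⟨
    ⟦ w *ₚ w ⟧        ∎)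
    where
    open ≈-Reasoning
    z≈-w : ⟦ z ⟧ ≈ - ⟦ w ⟧
    z≈-w = ≈-trans (≈-reflexive (cong ⟦_⟧ z≡-w)) (⟦-ₚ⟧ w)

  QR? : ∀ x → Dec (QR x)
  QR? x = map′ (λ (z , z≢0 , x≡z²) → (z , z≢0) , x≡z²) (λ ((z , z≢0) , x≡z²) → z , z≢0 , x≡z²)
               (any? (λ z → ¬? (toℕ z ℕ.≟ 0) ×-dec (x Fin.≟ sq z)))

  module _ (u : Zₚ) where

    Linked : Zₚ → Zₚ → Set
    Linked x y = x ≡ y ⊎ (QR x × y ≡ u *ₚ x) ⊎ (QR y × x ≡ u *ₚ y)

    Rel∼⇒Linked : ∀ {x y} → Rel∼ u x y → Linked (proj₁ x) (proj₁ y)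
    Rel∼⇒Linked {_ , _} {_ , _} (inj₁ (_ , _ , x≡y))        = inj₁ x≡y
    Rel∼⇒Linked {_ , _} {_ , _} (inj₂ (inj₁ (_ , _ , x≡y))) = inj₁ x≡y
    Rel∼⇒Linked {_ , _} {_ , _} (inj₂ (inj₂ (inj₁ (z , w , x≡z² , y≡uw² , z≡±w)))) =
      inj₂ (inj₁ ((z , x≡z²) , trans y≡uw² (cong (u *ₚ_) (trans (sym (-ₚ-square _ _ z≡±w)) (sym x≡z²)))))
    Rel∼⇒Linked {_ , _} {_ , _} (inj₂ (inj₂ (inj₂ (z , w , x≡uz² , y≡w² , z≡±w)))) =
      inj₂ (inj₂ ((w , y≡w²) , trans x≡uz² (cong (u *ₚ_) (trans (-ₚ-square _ _ z≡±w) (sym y≡w²)))))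

    Linked⇒Rel∼ : ∀ {x y} → Linked (proj₁ x) (proj₁ y) → Rel∼ u x y
    Linked⇒Rel∼ {x , _} {_ , _} (inj₁ refl) with QR? x
    ... | yes x∈QR = inj₁ (x∈QR , x∈QR , refl)
    ... | no  x∉QR = inj₂ (inj₁ (x∉QR , x∉QR , refl))
    Linked⇒Rel∼ {_ , _} {_ , _} (inj₂ (inj₁ ((z , x≡z²) , y≡ux))) =
      inj₂ (inj₂ (inj₁ (z , z , x≡z² , trans y≡ux (cong (u *ₚ_) x≡z²) , inj₁ refl)))
    Linked⇒Rel∼ {_ , _} {_ , _} (inj₂ (inj₂ ((w , y≡w²) , x≡uy))) =
      inj₂ (inj₂ (inj₂ (w , w , trans x≡uy (cong (u *ₚ_) y≡w²) , y≡w² , inj₁ refl)))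

    Linked-sym : ∀ {x y} → Linked x y → Linked y x
    Linked-sym (inj₁ x≡y)        = inj₁ (sym x≡y)
    Linked-sym (inj₂ (inj₁ x~y)) = inj₂ (inj₂ x~y)
    Linked-sym (inj₂ (inj₂ x~y)) = inj₂ (inj₁ x~y)

    Linked-trans : (∀ {x} → QR x → ¬ QR (u *ₚ x)) → (∀ {x y} → u *ₚ x ≡ u *ₚ y → x ≡ y) →
                   ∀ {x y w} → Linked x y → Linked y w → Linked x w
    Linked-trans _ _ (inj₁ refl) y~w = y~w
    Linked-trans _ _ x~y (inj₁ refl) = x~y
    Linked-trans u□∉QR _ (inj₂ (inj₁ (x∈QR , y≡ux))) (inj₂ (inj₁ (y∈QR , _))) =
      contradiction (subst QR y≡ux y∈QR) (u□∉QR x∈QR)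
    Linked-trans _ u-cancel (inj₂ (inj₁ (_ , y≡ux))) (inj₂ (inj₂ (_ , y≡uw))) =
      inj₁ (u-cancel (trans (sym y≡ux) y≡uw))
    Linked-trans _ _ (inj₂ (inj₂ (_ , x≡uy))) (inj₂ (inj₁ (_ , w≡uy))) = inj₁ (trans x≡uy (sym w≡uy))
    Linked-trans u□∉QR _ (inj₂ (inj₂ (y∈QR , _))) (inj₂ (inj₂ (w∈QR , y≡uw))) =
      contradiction (subst QR y≡uw y∈QR) (u□∉QR w∈QR)

    nonsquare·square∉QR : ¬ QR u → ∀ {x} → QR x → ¬ QR (u *ₚ x)
    nonsquare·square∉QR u∉QR {x} ((z , z≢0) , x≡z²) ((w , w≢0) , ux≡w²) =
      u∉QR ((s , s≢0) , ⟦⟧-injective u≈s²)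
      where
      open ≈-Reasoning
      s = w *ₚ z ⁻¹
      z·z⁻¹≈1 : ⟦ z ⟧ * ⟦ z ⁻¹ ⟧ ≈ 1ℤ
      z·z⁻¹≈1 = ⁻¹-inverseʳ z (unit⇒≉0 z≢0)
      s≢0 : toℕ s ≢ 0
      s≢0 = ≉0⇒unit
        (*-≉0 (unit⇒≉0 w≢0) (ab≈1⇒b≉0 ⟦ z ⟧ _ 1≉0 z·z⁻¹≈1) ∘ ≈-trans (≈-sym (⟦*ₚ⟧ w (z ⁻¹))))
      uz²≈w² : ⟦ u ⟧ * (⟦ z ⟧ * ⟦ z ⟧) ≈ ⟦ w ⟧ * ⟦ w ⟧
      uz²≈w² = begin
        ⟦ u ⟧ * (⟦ z ⟧ * ⟦ z ⟧)  ≈⟨ *-cong (≈-refl {⟦ u ⟧}) (⟦*ₚ⟧ z z) ⟨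
        ⟦ u ⟧ * ⟦ sq z ⟧         ≈⟨ ⟦*ₚ⟧ u (sq z) ⟨
        ⟦ u *ₚ sq z ⟧            ≡⟨ cong (λ y → ⟦ u *ₚ y ⟧) x≡z² ⟨
        ⟦ u *ₚ x ⟧               ≡⟨ cong ⟦_⟧ ux≡w² ⟩
        ⟦ sq w ⟧                 ≈⟨ ⟦*ₚ⟧ w w ⟩
        ⟦ w ⟧ * ⟦ w ⟧            ∎
      u≈s² : ⟦ u ⟧ ≈ ⟦ sq s ⟧
      u≈s² = begin
        ⟦ u ⟧                                    ≈⟨ aw²≈z²⇒a≈[zb]² ⟦ u ⟧ ⟦ z ⟧ ⟦ w ⟧ _ uz²≈w² z·z⁻¹≈1 ⟩
        (⟦ w ⟧ * ⟦ z ⁻¹ ⟧) * (⟦ w ⟧ * ⟦ z ⁻¹ ⟧)  ≈⟨ *-cong (⟦*ₚ⟧ w (z ⁻¹)) (⟦*ₚ⟧ w (z ⁻¹)) ⟨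
        ⟦ s ⟧ * ⟦ s ⟧                            ≈⟨ ⟦*ₚ⟧ s s ⟨
        ⟦ sq s ⟧                                 ∎

    Rel∼-isEquivalence : ¬ QR u → ⟦ u ⟧ ≉ 0ℤ → IsEquivalence (Rel∼ u)
    Rel∼-isEquivalence u∉QR u≉0 = record
      { refl  = λ {x} → Linked⇒Rel∼ {x} {x} (inj₁ refl)
      ; sym   = λ {x} {y} x∼y → Linked⇒Rel∼ {y} {x} (Linked-sym (Rel∼⇒Linked {x} {y} x∼y))
      ; trans = λ {x} {y} {w} x∼y y∼w → Linked⇒Rel∼ {x} {w}
          (Linked-trans (nonsquare·square∉QR u∉QR) (*ₚ-cancelˡ u≉0)
                        (Rel∼⇒Linked {x} {y} x∼y) (Rel∼⇒Linked {y} {w} y∼w))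
      }

    Rel∼-nontrivial : + 2 ≉ 0ℤ → ⟦ u ⟧ + 1ℤ ≉ 0ℤ → Nontrivial (Rel∼ u)
    Rel∼-nontrivial 2≉0 u+1≉0 = 1ᵤ , -1ᵤ , 1≁-1 ∘ Rel∼⇒Linked {1ᵤ} { -1ᵤ}
      where
      1ᵤ : Unit
      1ᵤ = one , ≉0⇒unit (1≉0 ∘ ≈-trans (≈-sym ⟦one⟧))
      -1ᵤ : Unit
      -1ᵤ = fromℤ (- 1ℤ) , ≉0⇒unit (λ -1≈0 →
        1≉0 (≈-by₁ (≈-trans (≈-sym (⟦fromℤ⟧ (- 1ℤ))) -1≈0) (- 1ℤ) refl))
      1≁-1 : ¬ Linked one (fromℤ (- 1ℤ))
      1≁-1 (inj₁ 1≡-1) = 2≉0 (≈-by₁ (≈-trans (≈-sym ⟦one⟧) (≡fromℤ⇒≈ (- 1ℤ) 1≡-1)) 1ℤ refl)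
      1≁-1 (inj₂ (inj₁ (_ , -1≡u·1))) = u+1≉0 (a*c≈-1⇒a+1≈0 ⟦ u ⟧ ⟦ one ⟧ ⟦one⟧
        (≈-trans (≈-sym (⟦*ₚ⟧ u one)) (≡fromℤ⇒≈ (- 1ℤ) (sym -1≡u·1))))
      1≁-1 (inj₂ (inj₂ (_ , 1≡u·-1))) = u+1≉0 (a*c≈1⇒a+1≈0 ⟦ u ⟧ _ (⟦fromℤ⟧ (- 1ℤ))
        (≈-trans (≈-sym (⟦*ₚ⟧ u _)) (≡fromℤ⇒≈ 1ℤ (sym 1≡u·-1))))

    module _ (u-primitive : PrimitiveRoot6 u) where

      private
        uᵏ≈1⇒uᵏ≡1 : ∀ k → ⟦ u ⟧ ^ k ≈ 1ℤ → u ^ₚ k ≡ one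
        uᵏ≈1⇒uᵏ≡1 k = ≈⇒≡fromℤ ∘ ≈-trans (⟦^ₚ⟧ u k)

        u⁶≈1 : ⟦ u ⟧ ^ 6 ≈ 1ℤ
        u⁶≈1 = ≈-trans (≈-sym (⟦^ₚ⟧ u 6)) (≡fromℤ⇒≈ 1ℤ (proj₁ u-primitive))

      primitive⇒≉0 : ⟦ u ⟧ ≉ 0ℤ
      primitive⇒≉0 = ^suc≈1⇒≉0 ⟦ u ⟧ 5 u⁶≈1

      primitive⇒+1≉0 : ⟦ u ⟧ + 1ℤ ≉ 0ℤ
      primitive⇒+1≉0 = proj₂ u-primitive 2 (s≤s z≤n) (s≤s (s≤s (s≤s z≤n))) ∘ uᵏ≈1⇒uᵏ≡1 2 ∘ a+1≈0⇒a²≈1 ⟦ u ⟧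

      primitive⇒³≈-1 : ⟦ u ⟧ ^ 3 + 1ℤ ≈ 0ℤ
      primitive⇒³≈-1 =
        Sum.fromInj₂ (λ u³≈1 → contradiction (uᵏ≈1⇒uᵏ≡1 3 u³≈1) u³≢1) (^6≈1⇒^3≈1⊎^3≈-1 ⟦ u ⟧ u⁶≈1)
        where
        u³≢1 : u ^ₚ 3 ≢ one
        u³≢1 = proj₂ u-primitive 3 (s≤s z≤n) (s≤s (s≤s (s≤s (s≤s z≤n))))

      primitive⇒∉QR : + 2 ≉ 0ℤ → ¬ 4 ℕ∣.∣ p ∸ 1 → ¬ QR u
      primitive⇒∉QR 2≉0 4∤p∸1 ((s , _) , u≡s²) =
        4∤p∸1 (order∣p∸1 i 3 (i²≈-1⇒i⁴≈1 i i²+1≈0) (λ 0<j j<4 → 2≉0 ∘ i²≈-1⇒iʲ≈1⇒2≈0 i i²+1≈0 0<j j<4))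
        where
        i = ⟦ s ⟧ ^ 3
        i²+1≈0 : i ^ 2 + 1ℤ ≈ 0ℤ
        i²+1≈0 = a≈s²⇒[s³]²+1≈0 ⟦ u ⟧ ⟦ s ⟧
          (≈-trans (≈-reflexive (cong ⟦_⟧ u≡s²)) (⟦*ₚ⟧ s s)) primitive⇒³≈-1

lemma3p11 : (p : ℕ) (pr : Prime p) → p % 12 ≡ 7 →
  (∃ λ u → Zp.PrimitiveRoot6 p {{prime⇒nonZero pr}} u)
  × (∀ u → Zp.PrimitiveRoot6 p {{prime⇒nonZero pr}} u →
       Zp.NontrivialEquivalence p {{prime⇒nonZero pr}} (Zp.Rel∼ p {{prime⇒nonZero pr}} u))
lemma3p11 p p-prime p%12≡7 =
    map₂ (Φ₆-root⇒primitive 6≉0) (Φ₆-has-root (3∤p∸2 (p / 12) p≡7+[p/12]*12))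
  , λ u u-primitive →
        Rel∼-isEquivalence u (primitive⇒∉QR u u-primitive 2≉0 (4∤p∸1 (p / 12) p≡7+[p/12]*12))
                             (primitive⇒≉0 u u-primitive)
      , Rel∼-nontrivial u 2≉0 (primitive⇒+1≉0 u u-primitive)
  where
  open Residues p p-prime

  p≡7+[p/12]*12 : p ≡ 7 ℕ.+ p / 12 ℕ.* 12
  p≡7+[p/12]*12 = m%12≡7⇒m≡7+[m/12]*12 p%12≡7

  7≤p : 7 ≤ p
  7≤p = subst (7 ≤_) (sym p≡7+[p/12]*12) (ℕ.m≤m+n 7 _)

  2≉0 : + 2 ≉ 0ℤ
  2≉0 = +n≉0 (s≤s z≤n) (ℕ.≤-trans (s≤s (s≤s (s≤s z≤n))) 7≤p)

  6≉0 : + 6 ≉ 0ℤ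
  6≉0 = +n≉0 (s≤s z≤n) 7≤p
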